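{- Let $G=(V,E)$ be a finite simple $C_4$-free graph. The algorithm $\mathrm{EnumIM}(G)$ described in the context outputs every induced matching of $G$, outputs only induced matchings of $G$, and outputs each induced matching exactly once.
   Context: Graphs are finite, undirected, without loops or parallel edges. A graph is $C_4$-free if it contains no cycle of length four as a subgraph. An induced matching of $G$ is a set $M\subseteq E$ of edges such that for any two distinct $e,e'\in M$, $e$ and $e'$ share no endpoint and no edge of $G$ joins an endpoint of $e$ to an endpoint of $e'$ (equivalently $\mathrm{dist}_G(e,e')\ge 2$, where the distance between edges is the minimum distance between their endpoints). For a graph $H$, a vertex $v$ and integers $k,\ell$, let $D_v(k,\ell)=\{\{x,y\}\in E(H): \mathrm{dist}_H(x,v)=k,\ \mathrm{dist}_H(y,v)=\ell\}$ and $D_v(k)=D_v(k,k)\cup D_v(k,k+1)$; for an edge $e$ incident to $v$, $\mathrm{Sect}_e(2)=\{f\in D_v(2): \mathrm{dist}_H(v,f)=2,\ \mathrm{dist}_H(e,f)=1\}$. The algorithm $\mathrm{EnumIM}(G)$ calls $\mathrm{Rec}(\emptyset,G)$, where $\mathrm{Rec}(M,H)$ is: if $H$ has no edges, output $M$ and return; otherwise choose a vertex $v$ of maximum degree in $H$; call $\mathrm{Rec}(M,H\setminus\{v\})$ (delete vertex $v$); then let $H'$ be the graph obtained from $H$ by deleting the closed neighbourhood $N_H[v]$; for each edge $e$ of $H$ incident to $v$, call $\mathrm{Rec}(M\cup\{e\},H'\setminus \mathrm{Sect}_e(2))$ (deleting the edges of $\mathrm{Sect}_e(2)$, computed in $H$);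 then return. -}

module Defs where

open import Data.Nat using (ℕ; zero; suc; _+_; _*_; _≤_)
open import Data.Bool using (Bool; true; false; _∧_; _∨_; not; if_then_else_)
open import Data.Fin using (Fin; _≟_)
open import Data.List using (List; []; _∷_; _++_; concatMap; allFin; map; length; lookup)
open import Data.Bool.ListAction using (any)
open import Data.Nat.ListAction using (sum)
open import Data.List.Membership.Propositional using (_∈_)
open import Data.Product using (_×_; _,_; ∃)
open import Data.Sum using (_⊎_)
open import Relation.Nullary using (¬_)
open import Relation.Nullary.Decidable using (⌊_⌋)
open import Relation.Binary.PropositionalEquality using (_≡_; _≢_)

-- A graph on vertex set Fin n, given by a Boolean adjacency relation.
-- (Deleting vertices is modelled by deleting all edges at them, i.e. making them isolated.)
Adj : ℕ → Set
Adj n = Fin n → Fin n → Bool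

module _ {n : ℕ} where

  Symmetric : Adj n → Set
  Symmetric G = ∀ x y → G x y ≡ G y x

  Loopless : Adj n → Set
  Loopless G = ∀ x → G x x ≡ false

  C4Free : Adj n → Set
  C4Free G = ∀ a b c d → a ≢ b → a ≢ c → a ≢ d → b ≢ c → b ≢ d → c ≢ d →
    ¬ (G a b ≡ true × G b c ≡ true × G c d ≡ true × G d a ≡ true)

  _==_ : Fin n → Fin n → Bool
  x == y = ⌊ x ≟ y ⌋

  b2n : Bool → ℕ
  b2n true = 1
  b2n false = 0

  deg : Adj n → Fin n → ℕ
  deg H w = sum (map (λ u → b2n (H w u)) (allFin n))

  hasEdge : Adj n → Bool
  hasEdge H = any (λ x → any (λ y → H x y) (allFin n)) (allFin n)

  IsMaxDegChoice : (Adj n → Fin n) → Set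
  IsMaxDegChoice sel = ∀ H → hasEdge H ≡ true → ∀ w → deg H w ≤ deg H (sel H)

  reach : Adj n → ℕ → Fin n → Fin n → Bool
  reach H zero v x = v == x
  reach H (suc k) v x = reach H k v x ∨ any (λ y → reach H k v y ∧ H y x) (allFin n)

  distIs : Adj n → ℕ → Fin n → Fin n → Bool
  distIs H zero v x = v == x
  distIs H (suc k) v x = reach H (suc k) v x ∧ not (reach H k v x)

  inD : Adj n → Fin n → ℕ → ℕ → Fin n → Fin n → Bool
  inD H v k l x y = H x y ∧ ((distIs H k v x ∧ distIs H l v y) ∨ (distIs H k v y ∧ distIs H l v x))

  inDk : Adj n → Fin n → ℕ → Fin n → Fin n → Bool
  inDk H v k x y = inD H v k k x y ∨ inD H v k (suc k) x y

  reachVE : Adj n → ℕ → Fin n → Fin n → Fin n → Bool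
  reachVE H k v x y = reach H k v x ∨ reach H k v y

  distVEIs : Adj n → ℕ → Fin n → Fin n → Fin n → Bool
  distVEIs H zero v x y = reachVE H zero v x y
  distVEIs H (suc k) v x y = reachVE H (suc k) v x y ∧ not (reachVE H k v x y)

  reachEE : Adj n → ℕ → Fin n → Fin n → Fin n → Fin n → Bool
  reachEE H k a b c d = reachVE H k a c d ∨ reachVE H k b c d

  distEEIs : Adj n → ℕ → Fin n → Fin n → Fin n → Fin n → Bool
  distEEIs H zero a b c d = reachEE H zero a b c d
  distEEIs H (suc k) a b c d = reachEE H (suc k) a b c d ∧ not (reachEE H k a b c d)

  inSect : Adj n → Fin n → Fin n → Fin n → Fin n → Bool
  inSect H v u x y = inDk H v 2 x y ∧ distVEIs H 2 v x y ∧ distEEIs H 1 v u x y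

  deleteVertex : Adj n → Fin n → Adj n
  deleteVertex H v x y = H x y ∧ not (x == v) ∧ not (y == v)

  deleteClosedNbhd : Adj n → Fin n → Adj n
  deleteClosedNbhd H v x y = H x y ∧ not (inN x) ∧ not (inN y)
    where inN : Fin n → Bool
          inN z = (z == v) ∨ H v z

  -- H' \ Sect_e(2), with Sect_e(2) computed in H, e = {v,u}
  branchGraph : Adj n → Fin n → Fin n → Adj n
  branchGraph H v u x y = deleteClosedNbhd H v x y ∧ not (inSect H v u x y)

  Matching : Set
  Matching = List (Fin n × Fin n)

  -- Rec(M,H) with a fuel argument (every call strictly decreases the number of
  -- edges, so fuel n*n+1 is never exhausted on a simple graph).
  rec : (Adj n → Fin n) → ℕ → Matching → Adj n → List Matching
  rec sel zero M H = []
  rec sel (suc f) M H =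
    if not (hasEdge H) then M ∷ [] else
      (rec sel f M (deleteVertex H v) ++
       concatMap (λ u → if H v u then rec sel f ((v , u) ∷ M) (branchGraph H v u) else [])
                 (allFin n))
    where v = sel H

  EnumIM : (Adj n → Fin n) → Adj n → List Matching
  EnumIM sel G = rec sel (suc (n * n)) [] G

  EdgeIn : Matching → Fin n → Fin n → Set
  EdgeIn M x y = (x , y) ∈ M ⊎ (y , x) ∈ M

  SameEdges : Matching → Matching → Set
  SameEdges L M = ∀ x y → (EdgeIn L x y → EdgeIn M x y) × (EdgeIn M x y → EdgeIn L x y)

  IsInducedMatching : Adj n → Matching → Set
  IsInducedMatching G M =
    (∀ x y → EdgeIn M x y → G x y ≡ true) ×
    (∀ a b c d → EdgeIn M a b → EdgeIn M c d →
       ¬ ((a ≡ c × b ≡ d) ⊎ (a ≡ d × b ≡ c)) →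
       (a ≢ c × a ≢ d × b ≢ c × b ≢ d) ×
       (G a c ≡ false × G a d ≡ false × G b c ≡ false × G b d ≡ false))

module Submission where

-- Deleting v removes exactly the edges at v; and for an edge e = {v,u}, removing
-- N[v] and then Sect_e(2) removes exactly the edges meeting N[v] ∪ N[u]
-- (branch-edge⇒ / branch-edge⇐).  Every call Rec(M,H) then satisfies an
-- invariant (Invariant): H is a symmetric subgraph of G induced on its non-isolated
-- vertices, M is an induced matching of G, and all G-neighbours of matched
-- vertices are isolated in H.  From it:
--   * soundness: at a leaf, M is an induced matching of G;
--   * completeness: following a target induced matching T (take the edge of T at
--     the chosen vertex v, or delete v when T misses v) reaches a leaf with
--     output T; termination uses the edge count and that v is not isolated;
--   * uniqueness: outputs of different branches differ at v — in the deletion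
--     branch v stays unmatched, in the branch of {v,u} its partner is u.

open import Defs
open import Data.Nat using (ℕ; zero; suc; _*_; _≤_; _<_; z≤n; s≤s; s≤s⁻¹)
open import Data.Nat.Properties
  using (≤-refl; ≤-trans; <-≤-trans; +-mono-≤; +-mono-<-≤; +-mono-≤-<; m≤m+n; m≤n+m; *-identityʳ)
open import Data.Nat.ListAction using (sum)
open import Data.Bool using (Bool; true; false; _∧_; _∨_; not; if_then_else_)
open import Data.Bool.Properties using (∧-conicalˡ; ∧-conicalʳ; ∨-conicalˡ; ∨-conicalʳ; ∨-comm; ¬-not; not-¬; ⇔→≡)
open import Data.Bool.ListAction using (any)
open import Data.Fin using (Fin; _≟_)
open import Data.List using (List; []; _∷_; _++_; concatMap; allFin; map; length; lookup)
open import Data.List.Properties using (length-tabulate)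
open import Data.List.Membership.Propositional using (_∈_; find; lose)
open import Data.List.Membership.Propositional.Properties
  using (∈-allFin; ∈-lookup; ∈-++⁻; ∈-++⁺ˡ; ∈-++⁺ʳ; ∈-concatMap⁻; ∈-concatMap⁺)
open import Data.List.Relation.Unary.Any using (here; there; any?)
open import Data.List.Relation.Unary.All as All using ([]; _∷_)
open import Data.List.Relation.Unary.AllPairs using (AllPairs; []; _∷_)
import Data.List.Relation.Unary.AllPairs.Properties as AllPairs
open import Data.List.Relation.Unary.Unique.Propositional using (Unique)
open import Data.List.Relation.Unary.Unique.Propositional.Properties using (allFin⁺)
open import Data.Product using (_×_; _,_; ∃; Σ; proj₁; proj₂)
open import Data.Sum using (_⊎_; inj₁; inj₂; swap)
open import Data.Empty using (⊥; ⊥-elim)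
open import Function.Bundles using (mk⇔)
open import Relation.Nullary using (¬_; yes; no)
open import Relation.Nullary.Decidable using (_×-dec_; _⊎-dec_)
open import Relation.Binary.PropositionalEquality using (_≡_; _≢_; refl; sym; trans; cong; cong₂; subst)

∧-intro : ∀ {a b} → a ≡ true → b ≡ true → a ∧ b ≡ true
∧-intro refl refl = refl

∨-introˡ : ∀ {a} b → a ≡ true → a ∨ b ≡ true
∨-introˡ b refl = refl

∨-introʳ : ∀ a {b} → b ≡ true → a ∨ b ≡ true
∨-introʳ true _ = refl
∨-introʳ false p = p

∨-elim : ∀ a {b} → a ∨ b ≡ true → a ≡ true ⊎ b ≡ true
∨-elim true _ = inj₁ refl
∨-elim false p = inj₂ p

∨-false : ∀ {a b} → a ≡ false → b ≡ false → a ∨ b ≡ false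
∨-false refl refl = refl

not-elim : ∀ a → not a ≡ true → a ≡ false
not-elim false _ = refl

true-iff⇒≡ : ∀ {a b} → (a ≡ true → b ≡ true) → (b ≡ true → a ≡ true) → a ≡ b
true-iff⇒≡ to from = ⇔→≡ (mk⇔ to from)

module _ {A : Set} where

  any-sound : (p : A → Bool) (xs : List A) → any p xs ≡ true → ∃ λ x → x ∈ xs × p x ≡ true
  any-sound p (x ∷ xs) q with ∨-elim (p x) q
  ... | inj₁ px = x , here refl , px
  ... | inj₂ rest with any-sound p xs rest
  ...   | y , y∈xs , py = y , there y∈xs , py

  any-complete : (p : A → Bool) {xs : List A} {x : A} → x ∈ xs → p x ≡ true → any p xs ≡ true
  any-complete p (here refl) px = ∨-introˡ _ px
  any-complete p {y ∷ _} (there x∈xs) px = ∨-introʳ (p y) (any-complete p x∈xs px)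

  sum-mono : (f g : A → ℕ) → (∀ x → f x ≤ g x) → (xs : List A) → sum (map f xs) ≤ sum (map g xs)
  sum-mono f g f≤g [] = z≤n
  sum-mono f g f≤g (x ∷ xs) = +-mono-≤ (f≤g x) (sum-mono f g f≤g xs)

  sum-mono-< : (f g : A → ℕ) → (∀ x → f x ≤ g x) → {xs : List A} {a : A} → a ∈ xs → f a < g a →
               sum (map f xs) < sum (map g xs)
  sum-mono-< f g f≤g {x ∷ xs} (here refl) lt = +-mono-<-≤ lt (sum-mono f g f≤g xs)
  sum-mono-< f g f≤g {x ∷ _} (there a∈xs) lt = +-mono-≤-< (f≤g x) (sum-mono-< f g f≤g a∈xs lt)

  sum-bound : (f : A → ℕ) (c : ℕ) → (∀ x → f x ≤ c) → (xs : List A) → sum (map f xs) ≤ length xs * c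
  sum-bound f c f≤c [] = z≤n
  sum-bound f c f≤c (x ∷ xs) = +-mono-≤ (f≤c x) (sum-bound f c f≤c xs)

  term≤sum : (f : A → ℕ) {xs : List A} {a : A} → a ∈ xs → f a ≤ sum (map f xs)
  term≤sum f {x ∷ _} (here refl) = m≤m+n (f x) _
  term≤sum f {x ∷ _} (there a∈xs) = ≤-trans (term≤sum f a∈xs) (m≤n+m _ (f x))

  allPairs-concatMap : {B : Set} (R : B → B → Set) (g : A → List B) (keys : List A) → Unique keys →
    (∀ k → AllPairs R (g k)) →
    (∀ {k k'} → k ≢ k' → ∀ {x y} → x ∈ g k → y ∈ g k' → R x y) →
    AllPairs R (concatMap g keys)
  allPairs-concatMap R g [] _ _ _ = []
  allPairs-concatMap R g (k ∷ keys) (k∉keys ∷ unique) within across =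
    AllPairs.++⁺ (within k) (allPairs-concatMap R g keys unique within across)
      (All.tabulate λ x∈ → All.tabulate λ y∈ → later x∈ (find (∈-concatMap⁻ g {xs = keys} y∈)))
    where
      later : ∀ {x y} → x ∈ g k → (∃ λ k' → k' ∈ keys × y ∈ g k') → R x y
      later x∈ (k' , k'∈keys , y∈) = across (All.lookup k∉keys k'∈keys) x∈ y∈

allPairs-lookup-injective : {B : Set} (S : B → B → Set) → (∀ {x y} → S x y → S y x) → (xs : List B) →
  AllPairs (λ x y → ¬ S x y) xs → (i j : Fin (length xs)) → S (lookup xs i) (lookup xs j) → i ≡ j
allPairs-lookup-injective S S-sym (x ∷ xs) (_ ∷ _) Fin.zero Fin.zero s = refl
allPairs-lookup-injective S S-sym (x ∷ xs) (x≁ ∷ _) Fin.zero (Fin.suc j) s =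
  ⊥-elim (All.lookup x≁ (∈-lookup j) s)
allPairs-lookup-injective S S-sym (x ∷ xs) (x≁ ∷ _) (Fin.suc i) Fin.zero s =
  ⊥-elim (All.lookup x≁ (∈-lookup i) (S-sym s))
allPairs-lookup-injective S S-sym (x ∷ xs) (_ ∷ rest) (Fin.suc i) (Fin.suc j) s =
  cong Fin.suc (allPairs-lookup-injective S S-sym xs rest i j s)

module _ {n : ℕ} where

  ==-sound : {x y : Fin n} → x == y ≡ true → x ≡ y
  ==-sound {x} {y} p with x ≟ y
  ... | yes x≡y = x≡y

  ==-refl : (x : Fin n) → x == x ≡ true
  ==-refl x with x ≟ x
  ... | yes _ = refl
  ... | no x≢x = ⊥-elim (x≢x refl)

  ==-false : {x y : Fin n} → x ≢ y → x == y ≡ false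
  ==-false {x} {y} x≢y with x ≟ y
  ... | yes x≡y = ⊥-elim (x≢y x≡y)
  ... | no _ = refl

  ==-false⇒≢ : {x y : Fin n} → x == y ≡ false → x ≢ y
  ==-false⇒≢ {x} p refl = not-¬ (==-refl x) p

  -- Subgraphs and the size measure: the sum of the degrees, which every
  -- recursive call strictly decreases.

  _⊆ᴳ_ : Adj n → Adj n → Set
  H' ⊆ᴳ H = ∀ {x y} → H' x y ≡ true → H x y ≡ true

  degreeSum : Adj n → ℕ
  degreeSum H = sum (map (deg H) (allFin n))

  b2n-mono : {a b : Bool} → (a ≡ true → b ≡ true) → b2n {n = n} a ≤ b2n {n = n} b
  b2n-mono {false} a⇒b = z≤n
  b2n-mono {true} a⇒b rewrite a⇒b refl = ≤-refl

  deg-mono : {H' H : Adj n} → H' ⊆ᴳ H → ∀ w → deg H' w ≤ deg H w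
  deg-mono H'⊆H w = sum-mono _ _ (λ u → b2n-mono H'⊆H) (allFin n)

  degreeSum-< : {H' H : Adj n} → H' ⊆ᴳ H → ∀ {a b} → H a b ≡ true → H' a b ≡ false → degreeSum H' < degreeSum H
  degreeSum-< {H'} {H} H'⊆H {a} {b} hab h'ab =
    sum-mono-< (deg H') (deg H) (deg-mono H'⊆H) (∈-allFin a)
      (sum-mono-< _ _ (λ u → b2n-mono H'⊆H) (∈-allFin b) lost)
    where lost : b2n {n = n} (H' a b) < b2n {n = n} (H a b)
          lost rewrite hab | h'ab = s≤s z≤n

  degreeSum-bound : (H : Adj n) → degreeSum H ≤ n * n
  degreeSum-bound H =
    subst (λ k → degreeSum H ≤ k * n) length-allFin (sum-bound (deg H) n deg≤n (allFin n))
    where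
      length-allFin : length (allFin n) ≡ n
      length-allFin = length-tabulate (λ x → x)
      b2n≤1 : (a : Bool) → b2n {n = n} a ≤ 1
      b2n≤1 true = ≤-refl
      b2n≤1 false = z≤n
      deg≤n : ∀ w → deg H w ≤ n
      deg≤n w = subst (deg H w ≤_) (trans (*-identityʳ _) length-allFin)
        (sum-bound _ 1 (λ u → b2n≤1 (H w u)) (allFin n))

  Live : Adj n → Fin n → Set
  Live H x = ∃ λ y → H x y ≡ true

  Isolated : Adj n → Fin n → Set
  Isolated H v = ∀ w → H v w ≡ false × H w v ≡ false

  edge⇒hasEdge : (H : Adj n) {x y : Fin n} → H x y ≡ true → hasEdge H ≡ true
  edge⇒hasEdge H {x} {y} h = any-complete _ (∈-allFin x) (any-complete _ (∈-allFin y) h)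

  no-edge : (H : Adj n) → hasEdge H ≡ false → ∀ x y → H x y ≡ false
  no-edge H e x y = ¬-not λ h → not-¬ (edge⇒hasEdge H h) e

  edge-dichotomy : (H : Adj n) → hasEdge H ≡ false ⊎ hasEdge H ≡ true
  edge-dichotomy H with hasEdge H
  ... | false = inj₁ refl
  ... | true = inj₂ refl

  -- A vertex of maximum degree in a graph with an edge has positive degree,
  -- hence a neighbour.
  maxDegree-live : (sel : Adj n → Fin n) → IsMaxDegChoice sel → (H : Adj n) → hasEdge H ≡ true → Live H (sel H)
  maxDegree-live sel isMax H e with any-sound _ (allFin n) e
  ... | x , _ , px with any-sound _ (allFin n) px
  ...   | y , _ , hxy = neighbour (allFin n) (≤-trans deg≥1 (isMax H e x))
    where
      deg≥1 : 1 ≤ deg H x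
      deg≥1 = ≤-trans (subst (λ b → 1 ≤ b2n {n = n} b) (sym hxy) ≤-refl) (term≤sum (λ u → b2n {n = n} (H x u)) (∈-allFin y))
      neighbour : (us : List (Fin n)) → 1 ≤ sum (map (λ u → b2n {n = n} (H (sel H) u)) us) → Live H (sel H)
      neighbour (u ∷ us) pos with H (sel H) u in hvu
      ... | true = u , hvu
      ... | false = neighbour us pos

  Near : Adj n → Fin n → Fin n → Set
  Near H a x = a ≡ x ⊎ H a x ≡ true

  reach1⇒near : (H : Adj n) {v x : Fin n} → reach H 1 v x ≡ true → Near H v x
  reach1⇒near H {v} {x} r with ∨-elim (v == x) r
  ... | inj₁ v==x = inj₁ (==-sound v==x)
  ... | inj₂ step with any-sound _ (allFin n) step
  ...   | y , _ , q with ==-sound {x = v} {y = y} (∧-conicalˡ (v == y) _ q)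
  ...     | refl = inj₂ (∧-conicalʳ (v == v) _ q)

  reach1-adjacent : (H : Adj n) {v x : Fin n} → H v x ≡ true → reach H 1 v x ≡ true
  reach1-adjacent H {v} {x} h = ∨-introʳ (v == x) (any-complete (λ y → (v == y) ∧ H y x) (∈-allFin v) (∧-intro (==-refl v) h))

  reach-step : (H : Adj n) (k : ℕ) {v y x : Fin n} → reach H k v y ≡ true → H y x ≡ true → reach H (suc k) v x ≡ true
  reach-step H k {v} {y} {x} r h = ∨-introʳ (reach H k v x) (any-complete (λ z → reach H k v z ∧ H z x) (∈-allFin y) (∧-intro r h))

  reach1-far : (H : Adj n) {v x : Fin n} → ¬ Near H v x → reach H 1 v x ≡ false
  reach1-far H far = ¬-not λ r → far (reach1⇒near H r)

  inSect-symmetric : (H : Adj n) → Symmetric H → ∀ v u x y → inSect H v u x y ≡ inSect H v u y x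
  inSect-symmetric H Hs v u x y =
    cong₂ _∧_ (cong₂ _∨_ (inD-sym 2 2) (inD-sym 2 3))
      (cong₂ _∧_ (cong₂ _∧_ (reachVE-sym 2 v) (cong not (reachVE-sym 1 v)))
                 (cong₂ _∧_ (reachEE-sym 1) (cong not (reachEE-sym 0))))
    where
      inD-sym : ∀ k l → inD H v k l x y ≡ inD H v k l y x
      inD-sym k l = cong₂ _∧_ (Hs x y) (∨-comm (distIs H k v x ∧ distIs H l v y) _)
      reachVE-sym : ∀ k a → reachVE H k a x y ≡ reachVE H k a y x
      reachVE-sym k a = ∨-comm (reach H k a x) (reach H k a y)
      reachEE-sym : ∀ k → reachEE H k v u x y ≡ reachEE H k v u y x
      reachEE-sym k = cong₂ _∨_ (reachVE-sym k v) (reachVE-sym k u)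

  inSect-intro : (H : Adj n) {v u x y : Fin n} → H v u ≡ true → H u x ≡ true → H x y ≡ true →
                 ¬ Near H v x → ¬ Near H v y → inSect H v u x y ≡ true
  inSect-intro H {v} {u} {x} {y} hvu hux hxy farx fary =
    ∧-intro inD2 (∧-intro (∧-intro (∨-introˡ _ reach2x) (cong not (∨-false reach1x reach1y)))
                          (∧-intro (∨-introʳ (reachVE H 1 v x y) (∨-introˡ _ (reach1-adjacent H hux)))
                                   (cong not (∨-false (∨-false (==-false v≢x) (==-false v≢y))
                                                      (∨-false (==-false u≢x) (==-false u≢y))))))
    where
      v≢x : v ≢ x
      v≢x e = farx (inj₁ e)
      v≢y : v ≢ y
      v≢y e = fary (inj₁ e)
      u≢x : u ≢ x
      u≢x refl = farx (inj₂ hvu)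
      u≢y : u ≢ y
      u≢y refl = fary (inj₂ hvu)
      reach1x = reach1-far H farx
      reach1y = reach1-far H fary
      reach2x = reach-step H 1 (reach1-adjacent H hvu) hux
      dist2x : distIs H 2 v x ≡ true
      dist2x = ∧-intro reach2x (cong not reach1x)
      -- y is at distance 2 or 3 from v, so xy lies in D_v(2,2) or D_v(2,3)
      inD2 : inDk H v 2 x y ≡ true
      inD2 = byDistance (reach H 2 v y) refl
        where
          byDistance : (b : Bool) → reach H 2 v y ≡ b → inDk H v 2 x y ≡ true
          byDistance true reach2y = ∨-introˡ _ (∧-intro hxy (∨-introˡ _ (∧-intro dist2x (∧-intro reach2y (cong not reach1y)))))
          byDistance false reach2y = ∨-introʳ (inD H v 2 2 x y)
            (∧-intro hxy (∨-introˡ _ (∧-intro dist2x (∧-intro (reach-step H 2 reach2x hxy) (cong not reach2y)))))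

  inSect⇒near : (H : Adj n) {v u x y : Fin n} → inSect H v u x y ≡ true →
                (Near H v x ⊎ Near H v y) ⊎ (Near H u x ⊎ Near H u y)
  inSect⇒near H {v} {u} {x} {y} s
    with ∨-elim (reachVE H 1 v x y) (∧-conicalˡ (reachEE H 1 v u x y) _ (∧-conicalʳ (distVEIs H 2 v x y) _ (∧-conicalʳ (inDk H v 2 x y) _ s)))
  ... | inj₁ nearV with ∨-elim (reach H 1 v x) nearV
  ...   | inj₁ r = inj₁ (inj₁ (reach1⇒near H r))
  ...   | inj₂ r = inj₁ (inj₂ (reach1⇒near H r))
  inSect⇒near H {v} {u} {x} {y} s | inj₂ nearU with ∨-elim (reach H 1 u x) nearU
  ...   | inj₁ r = inj₂ (inj₁ (reach1⇒near H r))
  ...   | inj₂ r = inj₂ (inj₂ (reach1⇒near H r))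

  deleteVertex⊆ : (H : Adj n) (v : Fin n) → deleteVertex H v ⊆ᴳ H
  deleteVertex⊆ H v {x} {y} p = ∧-conicalˡ (H x y) _ p

  deleteVertex-edge⇒ : (H : Adj n) (v : Fin n) {x y : Fin n} → deleteVertex H v x y ≡ true → x ≢ v × y ≢ v
  deleteVertex-edge⇒ H v {x} {y} p =
    ==-false⇒≢ (not-elim (x == v) (∧-conicalˡ _ _ rest)) , ==-false⇒≢ (not-elim (y == v) (∧-conicalʳ _ _ rest))
    where rest = ∧-conicalʳ (H x y) _ p

  deleteVertex-edge⇐ : (H : Adj n) (v : Fin n) {x y : Fin n} → H x y ≡ true → x ≢ v → y ≢ v → deleteVertex H v x y ≡ true
  deleteVertex-edge⇐ H v h x≢v y≢v = ∧-intro h (∧-intro (cong not (==-false x≢v)) (cong not (==-false y≢v)))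

  deleteVertex-symmetric : (H : Adj n) (v : Fin n) → Symmetric H → Symmetric (deleteVertex H v)
  deleteVertex-symmetric H v Hs x y = true-iff⇒≡ flip flip
    where
      flip : ∀ {a b} → deleteVertex H v a b ≡ true → deleteVertex H v b a ≡ true
      flip {a} {b} p = let (a≢v , b≢v) = deleteVertex-edge⇒ H v p
                       in deleteVertex-edge⇐ H v (trans (Hs b a) (deleteVertex⊆ H v p)) b≢v a≢v

  deleteVertex-isolates : (H : Adj n) (v : Fin n) → Isolated (deleteVertex H v) v
  deleteVertex-isolates H v w = ¬-not (λ p → proj₁ (deleteVertex-edge⇒ H v p) refl) ,
                                ¬-not (λ p → proj₂ (deleteVertex-edge⇒ H v p) refl)

  Away : Adj n → Fin n → Fin n → Fin n → Set
  Away H v u z = ¬ Near H v z × ¬ Near H u z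

  outside⇒¬near : (H : Adj n) {v z : Fin n} → not ((z == v) ∨ H v z) ≡ true → ¬ Near H v z
  outside⇒¬near H {v} {z} p (inj₁ refl) = not-¬ (==-refl z) (∨-conicalˡ _ _ (not-elim _ p))
  outside⇒¬near H {v} {z} p (inj₂ h) = not-¬ h (∨-conicalʳ (z == v) _ (not-elim _ p))

  ¬near⇒outside : (H : Adj n) {v z : Fin n} → ¬ Near H v z → not ((z == v) ∨ H v z) ≡ true
  ¬near⇒outside H far = cong not (∨-false (==-false λ e → far (inj₁ (sym e))) (¬-not λ h → far (inj₂ h)))

  branch⊆ : (H : Adj n) (v u : Fin n) → branchGraph H v u ⊆ᴳ H
  branch⊆ H v u {x} {y} p = ∧-conicalˡ (H x y) _ (∧-conicalˡ (deleteClosedNbhd H v x y) _ p)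

  branch-edge⇒ : (H : Adj n) → Symmetric H → {v u x y : Fin n} → H v u ≡ true →
                 branchGraph H v u x y ≡ true → Away H v u x × Away H v u y
  branch-edge⇒ H Hs {v} {u} {x} {y} hvu p = (farVx , farUx) , (farVy , farUy)
    where
      closed = ∧-conicalˡ (deleteClosedNbhd H v x y) _ p
      outside = ∧-conicalʳ (H x y) _ closed
      notSect : inSect H v u x y ≡ false
      notSect = not-elim _ (∧-conicalʳ (deleteClosedNbhd H v x y) _ p)
      hxy = branch⊆ H v u p
      farVx = outside⇒¬near H (∧-conicalˡ _ _ outside)
      farVy = outside⇒¬near H (∧-conicalʳ _ _ outside)
      farUx : ¬ Near H u x
      farUx (inj₁ refl) = farVx (inj₂ hvu)
      farUx (inj₂ hux) = not-¬ (inSect-intro H hvu hux hxy farVx farVy) notSect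
      farUy : ¬ Near H u y
      farUy (inj₁ refl) = farVy (inj₂ hvu)
      farUy (inj₂ huy) = not-¬ (trans (inSect-symmetric H Hs v u x y)
                                      (inSect-intro H hvu huy (trans (Hs y x) hxy) farVy farVx)) notSect

  branch-edge⇐ : (H : Adj n) {v u x y : Fin n} → H x y ≡ true → Away H v u x → Away H v u y → branchGraph H v u x y ≡ true
  branch-edge⇐ H {v} {u} {x} {y} hxy (farVx , farUx) (farVy , farUy) =
    ∧-intro (∧-intro hxy (∧-intro (¬near⇒outside H farVx) (¬near⇒outside H farVy)))
            (cong not (¬-not λ s → near (inSect⇒near H s)))
    where
      near : (Near H v x ⊎ Near H v y) ⊎ (Near H u x ⊎ Near H u y) → ⊥
      near (inj₁ (inj₁ q)) = farVx q
      near (inj₁ (inj₂ q)) = farVy q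
      near (inj₂ (inj₁ q)) = farUx q
      near (inj₂ (inj₂ q)) = farUy q

  branch-symmetric : (H : Adj n) → Symmetric H → {v u : Fin n} → H v u ≡ true → Symmetric (branchGraph H v u)
  branch-symmetric H Hs {v} {u} hvu x y = true-iff⇒≡ flip flip
    where
      flip : ∀ {a b} → branchGraph H v u a b ≡ true → branchGraph H v u b a ≡ true
      flip {a} {b} p = let (awayA , awayB) = branch-edge⇒ H Hs hvu p
                       in branch-edge⇐ H (trans (Hs b a) (branch⊆ H v u p)) awayB awayA

  branch-isolates : (H : Adj n) → Symmetric H → {v u : Fin n} → H v u ≡ true → Isolated (branchGraph H v u) v
  branch-isolates H Hs hvu w = ¬-not (λ p → proj₁ (proj₁ (branch-edge⇒ H Hs hvu p)) (inj₁ refl)) ,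
                               ¬-not (λ p → proj₁ (proj₂ (branch-edge⇒ H Hs hvu p)) (inj₁ refl))

  Matched : Matching → Fin n → Set
  Matched M z = ∃ λ w → EdgeIn M z w

  edgeIn-cons : {M : Matching} {v u a b : Fin n} → EdgeIn ((v , u) ∷ M) a b →
                ((a ≡ v × b ≡ u) ⊎ (a ≡ u × b ≡ v)) ⊎ EdgeIn M a b
  edgeIn-cons (inj₁ (here refl)) = inj₁ (inj₁ (refl , refl))
  edgeIn-cons (inj₁ (there m)) = inj₂ (inj₁ m)
  edgeIn-cons (inj₂ (here refl)) = inj₁ (inj₂ (refl , refl))
  edgeIn-cons (inj₂ (there m)) = inj₂ (inj₂ m)

  partner? : (M : Matching) (v : Fin n) → Matched M v ⊎ (∀ u → ¬ EdgeIn M v u)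
  partner? M v with any? (λ p → (proj₁ p ≟ v) ⊎-dec (proj₂ p ≟ v)) M
  ... | yes has with find has
  ...   | (a , b) , ab∈M , inj₁ refl = inj₁ (b , inj₁ ab∈M)
  ...   | (a , b) , ab∈M , inj₂ refl = inj₁ (a , inj₂ ab∈M)
  partner? M v | no none = inj₂ λ { u (inj₁ vu∈M) → none (lose vu∈M (inj₁ refl))
                                  ; u (inj₂ uv∈M) → none (lose uv∈M (inj₂ refl)) }

  module _ (G : Adj n) where

    Separated : Fin n → Fin n → Fin n → Fin n → Set
    Separated a b c d = (a ≢ c × a ≢ d × b ≢ c × b ≢ d) ×
                        (G a c ≡ false × G a d ≡ false × G b c ≡ false × G b d ≡ false)

    Apart : Fin n → Fin n → Set
    Apart a z = a ≢ z × G a z ≡ false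

    separated : ∀ {a b c d} → Apart a c → Apart a d → Apart b c → Apart b d → Separated a b c d
    separated (ac , gac) (ad , gad) (bc , gbc) (bd , gbd) = (ac , ad , bc , bd) , (gac , gad , gbc , gbd)

  module _ (G : Adj n) (Gs : Symmetric G) where

    apart-sym : ∀ {a z} → Apart G a z → Apart G z a
    apart-sym (a≢z , gaz) = (λ e → a≢z (sym e)) , trans (Gs _ _) gaz

    extend-induced-matching : ∀ {M v u} → IsInducedMatching G M → G v u ≡ true →
      (∀ {z} → Matched M z → Apart G v z × Apart G u z) → IsInducedMatching G ((v , u) ∷ M)
    extend-induced-matching {M} {v} {u} (inG , sep) gvu apart = edges , pairs
      where
        edges : ∀ x y → EdgeIn ((v , u) ∷ M) x y → G x y ≡ true
        edges x y p with edgeIn-cons p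
        ... | inj₁ (inj₁ (refl , refl)) = gvu
        ... | inj₁ (inj₂ (refl , refl)) = trans (Gs u v) gvu
        ... | inj₂ q = inG x y q
        new : ∀ {c d} → EdgeIn M c d → (Apart G v c × Apart G u c) × (Apart G v d × Apart G u d)
        new {c} {d} m = apart (d , m) , apart (c , swap m)
        pairs : ∀ a b c d → EdgeIn ((v , u) ∷ M) a b → EdgeIn ((v , u) ∷ M) c d →
                ¬ ((a ≡ c × b ≡ d) ⊎ (a ≡ d × b ≡ c)) → Separated G a b c d
        pairs a b c d p q distinct with edgeIn-cons p | edgeIn-cons q
        ... | inj₁ (inj₁ (refl , refl)) | inj₁ (inj₁ (refl , refl)) = ⊥-elim (distinct (inj₁ (refl , refl)))
        ... | inj₁ (inj₁ (refl , refl)) | inj₁ (inj₂ (refl , refl)) = ⊥-elim (distinct (inj₂ (refl , refl)))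
        ... | inj₁ (inj₂ (refl , refl)) | inj₁ (inj₁ (refl , refl)) = ⊥-elim (distinct (inj₂ (refl , refl)))
        ... | inj₁ (inj₂ (refl , refl)) | inj₁ (inj₂ (refl , refl)) = ⊥-elim (distinct (inj₁ (refl , refl)))
        ... | inj₁ (inj₁ (refl , refl)) | inj₂ m =
          let ((vc , uc) , (vd , ud)) = new m in separated G vc vd uc ud
        ... | inj₁ (inj₂ (refl , refl)) | inj₂ m =
          let ((vc , uc) , (vd , ud)) = new m in separated G uc ud vc vd
        ... | inj₂ m | inj₁ (inj₁ (refl , refl)) =
          let ((va , ua) , (vb , ub)) = new m in separated G (apart-sym va) (apart-sym ua) (apart-sym vb) (apart-sym ub)
        ... | inj₂ m | inj₁ (inj₂ (refl , refl)) =
          let ((va , ua) , (vb , ub)) = new m in separated G (apart-sym ua) (apart-sym va) (apart-sym ub) (apart-sym vb)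
        ... | inj₂ m | inj₂ m' = sep a b c d m m' distinct

module Recursion {n : ℕ} (sel : Adj n → Fin n) where

  takeCalls : ℕ → Matching → Adj n → Fin n → List Matching
  takeCalls f M H u = if H (sel H) u then rec sel f ((sel H , u) ∷ M) (branchGraph H (sel H) u) else []

  takeCalls-edge : ∀ {f M H u} → H (sel H) u ≡ true →
                   takeCalls f M H u ≡ rec sel f ((sel H , u) ∷ M) (branchGraph H (sel H) u)
  takeCalls-edge {f} {M} {H} hvu rewrite hvu = refl

  rec-leaf : ∀ {f M H} → hasEdge H ≡ false → rec sel (suc f) M H ≡ M ∷ []
  rec-leaf e rewrite e = refl

  rec-step : ∀ {f M H} → hasEdge H ≡ true →
             rec sel (suc f) M H ≡ rec sel f M (deleteVertex H (sel H)) ++ concatMap (takeCalls f M H) (allFin n)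
  rec-step e rewrite e = refl

  data Output (f : ℕ) (M : Matching) (H : Adj n) (L : Matching) : Set where
    leaf : L ≡ M → Output f M H L
    skip : L ∈ rec sel f M (deleteVertex H (sel H)) → Output f M H L
    take : ∀ u → H (sel H) u ≡ true → L ∈ rec sel f ((sel H , u) ∷ M) (branchGraph H (sel H) u) → Output f M H L

  output : ∀ {f M H L} → L ∈ rec sel (suc f) M H → Output f M H L
  output {f} {M} {H} {L} m with edge-dichotomy H
  ... | inj₁ e with subst (L ∈_) (rec-leaf {f} {M} {H} e) m
  ...   | here L≡M = leaf L≡M
  output {f} {M} {H} {L} m | inj₂ e
    with ∈-++⁻ (rec sel f M (deleteVertex H (sel H))) (subst (L ∈_) (rec-step {f} {M} {H} e) m)
  ...   | inj₁ m' = skip m'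
  ...   | inj₂ m' with find (∈-concatMap⁻ (takeCalls f M H) {xs = allFin n} m')
  ...     | u , _ , m'' with H (sel H) u in hvu
  ...       | true = take u hvu m''

  rec-∈-skip : ∀ {f M H L} → hasEdge H ≡ true → L ∈ rec sel f M (deleteVertex H (sel H)) → L ∈ rec sel (suc f) M H
  rec-∈-skip {f} {M} {H} e m = subst (_ ∈_) (sym (rec-step {f} {M} {H} e)) (∈-++⁺ˡ m)

  rec-∈-take : ∀ {f M H L} u → hasEdge H ≡ true → H (sel H) u ≡ true →
               L ∈ rec sel f ((sel H , u) ∷ M) (branchGraph H (sel H) u) → L ∈ rec sel (suc f) M H
  rec-∈-take {f} {M} {H} u e hvu m = subst (_ ∈_) (sym (rec-step {f} {M} {H} e))
    (∈-++⁺ʳ (rec sel f M (deleteVertex H (sel H)))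
            (∈-concatMap⁺ (takeCalls f M H) {xs = allFin n} (lose (∈-allFin u) (subst (_ ∈_) (sym (takeCalls-edge {f} {M} {H} hvu)) m))))

  output-extends : ∀ f {M H L p} → L ∈ rec sel f M H → p ∈ M → p ∈ L
  output-extends (suc f) {M} {H} m p∈M with output {f} {M} {H} m
  ... | leaf refl = p∈M
  ... | skip m' = output-extends f {M} {deleteVertex H (sel H)} m' p∈M
  ... | take u _ m' = output-extends f {(sel H , u) ∷ M} {branchGraph H (sel H) u} m' (there p∈M)

  output-pairs : ∀ f {M H L a b} → L ∈ rec sel f M H → (a , b) ∈ L → (a , b) ∈ M ⊎ H a b ≡ true
  output-pairs (suc f) {M} {H} m ab∈L with output {f} {M} {H} m
  ... | leaf refl = inj₁ ab∈L
  ... | skip m' with output-pairs f {M} {deleteVertex H (sel H)} m' ab∈L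
  ...   | inj₁ ab∈M = inj₁ ab∈M
  ...   | inj₂ h = inj₂ (deleteVertex⊆ H (sel H) h)
  output-pairs (suc f) {M} {H} m ab∈L | take u hvu m' with output-pairs f {(sel H , u) ∷ M} {branchGraph H (sel H) u} m' ab∈L
  ...   | inj₁ (here refl) = inj₂ hvu
  ...   | inj₁ (there ab∈M) = inj₁ ab∈M
  ...   | inj₂ h = inj₂ (branch⊆ H (sel H) u h)

  isolated-partner : ∀ f {M H L v w} → L ∈ rec sel f M H → Isolated H v → EdgeIn L v w → EdgeIn M v w
  isolated-partner f m iso (inj₁ vw∈L) with output-pairs f m vw∈L
  ... | inj₁ vw∈M = inj₁ vw∈M
  ... | inj₂ h = ⊥-elim (not-¬ h (proj₁ (iso _)))
  isolated-partner f m iso (inj₂ wv∈L) with output-pairs f m wv∈L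
  ... | inj₁ wv∈M = inj₂ wv∈M
  ... | inj₂ h = ⊥-elim (not-¬ h (proj₂ (iso _)))

module Invariants {n : ℕ} (G : Adj n) (Gs : Symmetric G) where

  record Invariant (M : Matching) (H : Adj n) : Set where
    field
      symmetric : Symmetric H
      subgraph : H ⊆ᴳ G
      matching : IsInducedMatching G M
      guarded : ∀ {z t} → Matched M z → G z t ≡ true → ¬ Live H t
      induced : ∀ {x z} → Live H x → Live H z → G x z ≡ true → H x z ≡ true
  open Invariant public

  initial : Invariant [] G
  initial = record
    { symmetric = Gs ; subgraph = λ p → p
    ; matching = (λ { x y (inj₁ ()) ; x y (inj₂ ()) }) , (λ { a b c d (inj₁ ()) _ _ ; a b c d (inj₂ ()) _ _ })
    ; guarded = λ { (_ , inj₁ ()) ; (_ , inj₂ ()) }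
    ; induced = λ _ _ g → g }

  -- Matched vertices are isolated in H (each is a G-neighbour of its partner) ...
  matched-isolated : ∀ {M H z} → Invariant M H → Matched M z → ¬ Live H z
  matched-isolated inv (w , zw) = guarded inv (_ , swap zw) (trans (Gs _ _) (proj₁ (matching inv) _ _ zw))

  live-apart : ∀ {M H a z} → Invariant M H → Live H a → Matched M z → Apart G a z
  live-apart inv la mz = (λ { refl → matched-isolated inv mz la }) ,
                         ¬-not (λ gaz → guarded inv mz (trans (Gs _ _) gaz) la)

  invariant-delete : ∀ {M H} v → Invariant M H → Invariant M (deleteVertex H v)
  invariant-delete {M} {H} v inv = record
    { symmetric = deleteVertex-symmetric H v (symmetric inv)
    ; subgraph = λ p → subgraph inv (deleteVertex⊆ H v p)
    ; matching = matching inv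
    ; guarded = λ mz g (s , p) → guarded inv mz g (s , deleteVertex⊆ H v p)
    ; induced = λ (s , p) (t , q) g →
        deleteVertex-edge⇐ H v (induced inv (s , deleteVertex⊆ H v p) (t , deleteVertex⊆ H v q) g)
          (proj₁ (deleteVertex-edge⇒ H v p)) (proj₁ (deleteVertex-edge⇒ H v q))
    }

  invariant-branch : ∀ {M H v u} → H v u ≡ true → Invariant M H → Invariant ((v , u) ∷ M) (branchGraph H v u)
  invariant-branch {M} {H} {v} {u} hvu inv = record
    { symmetric = branch-symmetric H Hs hvu
    ; subgraph = λ p → subgraph inv (branch⊆ H v u p)
    ; matching = extend-induced-matching G Gs (matching inv) (subgraph inv hvu)
                   (λ mz → live-apart inv liveV mz , live-apart inv liveU mz)
    ; guarded = guardedB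
    ; induced = λ lx lz g → let (lx' , awayX) = liveB lx ; (lz' , awayZ) = liveB lz
                            in branch-edge⇐ H (induced inv lx' lz' g) awayX awayZ
    }
    where
      Hs = symmetric inv
      liveV : Live H v
      liveV = u , hvu
      liveU : Live H u
      liveU = v , trans (Hs u v) hvu
      liveB : ∀ {x} → Live (branchGraph H v u) x → Live H x × Away H v u x
      liveB (s , p) = (s , branch⊆ H v u p) , proj₁ (branch-edge⇒ H Hs hvu p)
      guardedB : ∀ {z t} → Matched ((v , u) ∷ M) z → G z t ≡ true → ¬ Live (branchGraph H v u) t
      guardedB (w , zw) g lt with liveB lt | edgeIn-cons zw
      ... | lt' , (farV , _) | inj₁ (inj₁ (refl , _)) = farV (inj₂ (induced inv liveV lt' g))
      ... | lt' , (_ , farU) | inj₁ (inj₂ (refl , _)) = farU (inj₂ (induced inv liveU lt' g))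
      ... | lt' , _ | inj₂ zw' = guarded inv (w , zw') g lt'

module SoundAndUnique {n : ℕ} (sel : Adj n → Fin n) (G : Adj n) (Gs : Symmetric G) where
  open Recursion sel
  open Invariants G Gs

  sound : ∀ f {M H L} → Invariant M H → L ∈ rec sel f M H → IsInducedMatching G L
  sound (suc f) {M} {H} inv m with output {f} {M} {H} m
  ... | leaf refl = matching inv
  ... | skip m' = sound f (invariant-delete (sel H) inv) m'
  ... | take u hvu m' = sound f (invariant-branch hvu inv) m'

  Distinct : Matching {n} → Matching {n} → Set
  Distinct L L' = ¬ SameEdges L L'

  unique : ∀ f {M H} → Invariant M H → AllPairs Distinct (rec sel f M H)
  unique zero inv = []
  unique (suc f) {M} {H} inv with edge-dichotomy H
  ... | inj₁ e = subst (AllPairs Distinct) (sym (rec-leaf {f} {M} {H} e)) ([] ∷ [])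
  ... | inj₂ e = subst (AllPairs Distinct) (sym (rec-step {f} {M} {H} e))
      (AllPairs.++⁺ (unique f (invariant-delete v inv))
         (allPairs-concatMap Distinct (takeCalls f M H) (allFin n) (allFin⁺ n) takes takes-vs-takes)
         (All.tabulate λ x∈ → All.tabulate λ y∈ → skip-vs-take x∈ (find (∈-concatMap⁻ (takeCalls f M H) {xs = allFin n} y∈))))
    where
      v = sel H
      unmatched : ∀ {u} → H v u ≡ true → ∀ {w} → ¬ EdgeIn M v w
      unmatched hvu vw = matched-isolated inv (_ , vw) (_ , hvu)
      takes : ∀ u → AllPairs Distinct (takeCalls f M H u)
      takes u with H v u in hvu
      ... | true = unique f (invariant-branch hvu inv)
      ... | false = []
      in-take : ∀ {u L} → L ∈ takeCalls f M H u → H v u ≡ true × L ∈ rec sel f ((v , u) ∷ M) (branchGraph H v u)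
      in-take {u} m with H v u in hvu
      ... | true = refl , m
      ... | false with () ← m
      take-partner : ∀ {u L w} → L ∈ takeCalls f M H u → EdgeIn L v w → w ≡ u
      take-partner {u} m vw with in-take {u} m
      ... | hvu , m' with edgeIn-cons (isolated-partner f {(v , u) ∷ M} {branchGraph H v u} m' (branch-isolates H (symmetric inv) hvu) vw)
      ...   | inj₁ (inj₁ (_ , w≡u)) = w≡u
      ...   | inj₁ (inj₂ (v≡u , w≡v)) = trans w≡v v≡u
      ...   | inj₂ vw∈M = ⊥-elim (unmatched hvu vw∈M)
      take-matches : ∀ {u L} → L ∈ takeCalls f M H u → EdgeIn L v u
      take-matches {u} m = inj₁ (output-extends f {(v , u) ∷ M} {branchGraph H v u} (proj₂ (in-take {u} m)) (here refl))
      takes-vs-takes : ∀ {u u'} → u ≢ u' → ∀ {x y} → x ∈ takeCalls f M H u → y ∈ takeCalls f M H u' → Distinct x y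
      takes-vs-takes {u} {u'} u≢u' x∈ y∈ same = u≢u' (take-partner {u'} y∈ (proj₁ (same v u) (take-matches {u} x∈)))
      -- in the deletion branch, v stays unmatched
      skip-vs-take : ∀ {x y} → x ∈ rec sel f M (deleteVertex H v) → (∃ λ u → u ∈ allFin n × y ∈ takeCalls f M H u) → Distinct x y
      skip-vs-take x∈ (u , _ , y∈) same =
        unmatched (proj₁ (in-take {u} y∈))
          (isolated-partner f {M} {deleteVertex H v} x∈ (deleteVertex-isolates H v) (proj₂ (same v u) (take-matches {u} y∈)))

module Complete {n : ℕ} (sel : Adj n → Fin n) (picksLive : ∀ H → hasEdge H ≡ true → Live H (sel H))
                (G : Adj n) (Gs : Symmetric G) (T : Matching) (imT : IsInducedMatching G T) where
  open Recursion sel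
  open Invariants G Gs

  -- Along the path to T, T consists of the chosen edges and edges still present.
  record Tracks (M : Matching) (H : Adj n) : Set where
    field
      covered : ∀ {a b} → (a , b) ∈ T → EdgeIn M a b ⊎ H a b ≡ true
      chosen : ∀ {a b} → (a , b) ∈ M → EdgeIn T a b
  open Tracks

  initial-tracks : Tracks [] G
  initial-tracks = record { covered = λ ab∈T → inj₂ (proj₁ imT _ _ (inj₁ ab∈T)) ; chosen = λ () }

  tracks-leaf : ∀ {M H} → Tracks M H → hasEdge H ≡ false → SameEdges M T
  tracks-leaf {M} {H} tr e x y = to , from
    where
      to : EdgeIn M x y → EdgeIn T x y
      to (inj₁ xy∈M) = chosen tr xy∈M
      to (inj₂ yx∈M) = swap (chosen tr yx∈M)
      from : EdgeIn T x y → EdgeIn M x y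
      from (inj₁ xy∈T) with covered tr xy∈T
      ... | inj₁ xy = xy
      ... | inj₂ h = ⊥-elim (not-¬ h (no-edge H e x y))
      from (inj₂ yx∈T) with covered tr yx∈T
      ... | inj₁ yx = swap yx
      ... | inj₂ h = ⊥-elim (not-¬ h (no-edge H e y x))

  tracks-delete : ∀ {M H v} → (∀ u → ¬ EdgeIn T v u) → Tracks M H → Tracks M (deleteVertex H v)
  tracks-delete {H = H} {v} missed tr = record { covered = coveredD ; chosen = chosen tr }
    where
      coveredD : ∀ {a b} → (a , b) ∈ T → _
      coveredD {a} {b} ab∈T with covered tr ab∈T
      ... | inj₁ ab = inj₁ ab
      ... | inj₂ h = inj₂ (deleteVertex-edge⇐ H v h (λ { refl → missed b (inj₁ ab∈T) }) (λ { refl → missed a (inj₂ ab∈T) }))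

  tracked-edge : ∀ {M H v u} → Invariant M H → Tracks M H → Live H v → EdgeIn T v u → H v u ≡ true
  tracked-edge inv tr lv (inj₁ vu∈T) with covered tr vu∈T
  ... | inj₁ vu = ⊥-elim (matched-isolated inv (_ , vu) lv)
  ... | inj₂ h = h
  tracked-edge inv tr lv (inj₂ uv∈T) with covered tr uv∈T
  ... | inj₁ uv = ⊥-elim (matched-isolated inv (_ , swap uv) lv)
  ... | inj₂ h = trans (symmetric inv _ _) h

  -- Taking the edge vu of T keeps every other edge of T, as it is apart from vu.
  tracks-branch : ∀ {M H v u} → Invariant M H → EdgeIn T v u → Tracks M H → Tracks ((v , u) ∷ M) (branchGraph H v u)
  tracks-branch {M} {H} {v} {u} inv vu∈T tr = record { covered = coveredB ; chosen = chosenB }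
    where
      ¬near : ∀ {a x} → a ≢ x → G a x ≡ false → ¬ Near H x a
      ¬near a≢x _ (inj₁ refl) = a≢x refl
      ¬near _ gax (inj₂ h) = not-¬ (trans (Gs _ _) (subgraph inv h)) gax
      coveredB : ∀ {a b} → (a , b) ∈ T → EdgeIn ((v , u) ∷ M) a b ⊎ branchGraph H v u a b ≡ true
      coveredB {a} {b} ab∈T with covered tr ab∈T
      ... | inj₁ (inj₁ ab∈M) = inj₁ (inj₁ (there ab∈M))
      ... | inj₁ (inj₂ ba∈M) = inj₁ (inj₂ (there ba∈M))
      ... | inj₂ h with ((a ≟ v) ×-dec (b ≟ u)) ⊎-dec ((a ≟ u) ×-dec (b ≟ v))
      ...   | yes (inj₁ (refl , refl)) = inj₁ (inj₁ (here refl))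
      ...   | yes (inj₂ (refl , refl)) = inj₁ (inj₂ (here refl))
      ...   | no other =
        let ((av , au , bv , bu) , (gav , gau , gbv , gbu)) = proj₂ imT a b v u (inj₁ ab∈T) vu∈T other
        in inj₂ (branch-edge⇐ H h (¬near av gav , ¬near au gau) (¬near bv gbv , ¬near bu gbu))
      chosenB : ∀ {a b} → (a , b) ∈ ((v , u) ∷ M) → EdgeIn T a b
      chosenB (here refl) = vu∈T
      chosenB (there ab∈M) = chosen tr ab∈M

  complete : ∀ f {M H} → degreeSum H < f → Invariant M H → Tracks M H →
             Σ Matching λ L → L ∈ rec sel f M H × SameEdges L T
  complete (suc f) {M} {H} lt inv tr with edge-dichotomy H
  ... | inj₁ e = M , subst (M ∈_) (sym (rec-leaf {f} {M} {H} e)) (here refl) , tracks-leaf tr e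
  ... | inj₂ e with picksLive H e | partner? T (sel H)
  ...   | u₀ , hvu₀ | inj₂ missed =
    let (L , m , same) = complete f smaller (invariant-delete (sel H) inv) (tracks-delete missed tr)
    in L , rec-∈-skip {f} {M} {H} e m , same
    where
      smaller : degreeSum (deleteVertex H (sel H)) < f
      smaller = <-≤-trans (degreeSum-< {H' = deleteVertex H (sel H)} (deleteVertex⊆ H (sel H)) hvu₀ (proj₁ (deleteVertex-isolates H (sel H) u₀))) (s≤s⁻¹ lt)
  ...   | u₀ , hvu₀ | inj₁ (u , vu∈T) =
    let (L , m , same) = complete f smaller (invariant-branch hvu inv) (tracks-branch inv vu∈T tr)
    in L , rec-∈-take {f} {M} {H} u e hvu m , same
    where
      hvu = tracked-edge inv tr (u₀ , hvu₀) vu∈T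
      smaller : degreeSum (branchGraph H (sel H) u) < f
      smaller = <-≤-trans (degreeSum-< {H' = branchGraph H (sel H) u} (branch⊆ H (sel H) u) hvu (proj₁ (branch-isolates H (symmetric inv) hvu u))) (s≤s⁻¹ lt)

theorem1 : (n : ℕ) (G : Adj n) → Symmetric G → Loopless G → C4Free G →
    (sel : Adj n → Fin n) → IsMaxDegChoice sel →
    ((L : Matching) → L ∈ EnumIM sel G → IsInducedMatching G L) ×
    ((M : Matching) → IsInducedMatching G M → Σ Matching (λ L → L ∈ EnumIM sel G × SameEdges L M)) ×
    ((i j : Fin (length (EnumIM sel G))) →
    SameEdges (lookup (EnumIM sel G) i) (lookup (EnumIM sel G) j) → i ≡ j)
theorem1 n G Gs _ _ sel isMax =
  (λ L → sound fuel initial) ,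
  (λ T imT → Complete.complete sel (maxDegree-live sel isMax) G Gs T imT fuel (s≤s (degreeSum-bound G))
               initial (Complete.initial-tracks sel (maxDegree-live sel isMax) G Gs T imT)) ,
  allPairs-lookup-injective SameEdges SameEdges-sym (EnumIM sel G) (unique fuel initial)
  where
    open SoundAndUnique sel G Gs
    open Invariants G Gs using (initial)
    fuel = suc (n * n)
    SameEdges-sym : ∀ {L M} → SameEdges L M → SameEdges M L
    SameEdges-sym same x y = proj₂ (same x y) , proj₁ (same x y)
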